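{- In the graceful game on the cycle $C_n$, Bob has a winning strategy for every $n\geq 4$, and Alice has a winning strategy on $C_3$ (no matter who starts).
   Context: $C_n$ denotes the cycle on $n\geq 3$ vertices. A graceful labeling of a graph $G$ with $m$ edges is an injective map $f\colon V(G)\to\{0,1,\dots,m\}$ such that the induced edge labels $|f(u)-f(v)|$, $uv\in E(G)$, are pairwise distinct. The graceful game on a simple graph $G$ with $m$ edges: two players, Alice and Bob, alternately choose a free (not yet labeled) vertex and assign to it a label from $\{0,1,\dots,m\}$ not yet used. An edge both of whose endpoints are labeled gets label $|f(u)-f(v)|$; a move is legal only if after it all edge labels are pairwise distinct. Alice wins if the whole graph ends up gracefully labeled; Bob wins if he can prevent this. Either player may be the first to move. -}

module Defs where

open import Data.Nat using (ℕ; zero; suc; _≤_; ∣_-_∣)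
open import Data.Nat.DivMod using (_mod_)
open import Data.Fin using (Fin; toℕ; _≟_)
open import Data.Maybe using (Maybe; just; nothing)
open import Data.Product using (Σ; ∃; _×_)
open import Relation.Nullary using (¬_; yes; no)
open import Relation.Binary.PropositionalEquality using (_≡_; _≢_)

-- The cycle C_n: vertices Fin n, edge i joins vertex i and vertex (i+1 mod n).
-- C_n has n edges, so labels come from {0,…,n}.
next : ∀ {n} → Fin n → Fin n
next {suc k} i = suc (toℕ i) mod (suc k)

-- A (partial) labeling: nothing = free vertex, just l = vertex labeled l.
Labeling : ℕ → Set
Labeling n = Fin n → Maybe ℕ

emptyLabeling : ∀ {n} → Labeling n
emptyLabeling _ = nothing

edgeLabel : ∀ {n} → Labeling n → Fin n → Maybe ℕ
edgeLabel f i with f i | f (next i)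
... | just a | just b = just ∣ a - b ∣
... | _      | _      = nothing

EdgeLabelsDistinct : ∀ {n} → Labeling n → Set
EdgeLabelsDistinct {n} f =
  ∀ (i j : Fin n) (a b : ℕ) → i ≢ j →
    edgeLabel f i ≡ just a → edgeLabel f j ≡ just b → a ≢ b

update : ∀ {n} → Labeling n → Fin n → ℕ → Labeling n
update f v l w with w ≟ v
... | yes _ = just l
... | no  _ = f w

Legal : ∀ {n} → Labeling n → Fin n → ℕ → Set
Legal {n} f v l =
  f v ≡ nothing × l ≤ n × (∀ w → f w ≢ just l) × EdgeLabelsDistinct (update f v l)

Full : ∀ {n} → Labeling n → Set
Full f = ∀ v → ∃ λ l → f v ≡ just l

data Player : Set where
  alice bob : Player

-- Alice has a winning strategy from position f with the given player to move.
-- (If the player to move has no legal move and the graph is not fully labeled,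
--  the game ends and Bob wins.)
data AliceWins {n : ℕ} : Player → Labeling n → Set where
  done       : ∀ {p f} → Full f → AliceWins p f
  alice-move : ∀ {f} (v : Fin n) (l : ℕ) → Legal f v l →
               AliceWins bob (update f v l) → AliceWins alice f
  bob-move   : ∀ {f} → (Σ (Fin n) λ v → Σ ℕ λ l → Legal f v l) →
               (∀ v l → Legal f v l → AliceWins alice (update f v l)) →
               AliceWins bob f

data BobWins {n : ℕ} : Player → Labeling n → Set where
  stuck      : ∀ {p f} → ¬ Full f → (∀ v l → ¬ Legal f v l) → BobWins p f
  alice-turn : ∀ {f} → ¬ Full f →
               (∀ v l → Legal f v l → BobWins bob (update f v l)) →
               BobWins alice f
  bob-turn   : ∀ {f} (v : Fin n) (l : ℕ) → Legal f v l →
               BobWins alice (update f v l) → BobWins bob f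

module Submission where

-- Bob's strategies rest on one principle (dead-label-wins): the n edges of a
-- complete valid labeling of C_n carry n distinct labels from {1,…,n}, so
-- each such label occurs (no-missing-label, by pigeonhole).  Hence, as soon
-- as some label k ∈ {1,…,n} can appear in no completion ("k is dead"), Bob
-- wins by playing arbitrary legal moves.  His targets are k = n, which needs
-- 0 and n adjacent, and k = n − 1, which needs {0, n − 1} or {1, n} adjacent.
-- For n ≥ 8 (module LargeCycle) Bob puts 0 next to Alice's first label and
-- then separates one of these pairs after Alice's reply; an opening n − 1 is
-- answered through the symmetry l ↦ n − l (bob-wins-mirror).  The cycles
-- C_3, …, C_7 are settled by a certified exhaustive game-tree search that
-- prunes with a decidable test for dead labels (not-alive⇒dead).

open import Defs
open import Data.Nat using (ℕ; zero; suc; _+_; _∸_; _≤_; _<_; z≤n; s≤s; s≤s⁻¹; ∣_-_∣; _≤?_; _<ᵇ_)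
open import Data.Nat.Properties
open import Data.Nat.DivMod using (_%_; m<n⇒m%n≡m; n%n≡0)
open import Data.Fin using (Fin; toℕ; fromℕ<; punchOut) renaming (zero to fz; suc to fs)
import Data.Fin as F
import Data.Fin.Properties as FP
open import Data.Bool using (T; true; false)
open import Data.Maybe using (Maybe; just; nothing; map; from-just)
import Data.Maybe.Properties as MP
open import Data.Maybe.Properties using (just-injective)
open import Data.Product using (Σ; ∃; _×_; _,_; proj₁; proj₂)
open import Data.Sum using (_⊎_; inj₁; inj₂)
open import Data.Unit using (⊤; tt)
open import Data.Empty using (⊥; ⊥-elim)
open import Relation.Nullary using (¬_; Dec; does; _because_; yes; no)
open import Relation.Nullary.Reflects using (invert)
open import Relation.Nullary.Decidable using (_×-dec_; _⊎-dec_; _→-dec_; ¬?; map′; False; toWitnessFalse)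
open import Relation.Binary.Definitions using (tri<; tri≈; tri>)
open import Relation.Binary.PropositionalEquality

toℕ-next : ∀ {n} (i : Fin n) →
  toℕ (next i) ≡ suc (toℕ i) ⊎ (toℕ (next i) ≡ 0 × suc (toℕ i) ≡ n)
toℕ-next {suc k} i with m≤n⇒m<n∨m≡n (FP.toℕ<n i)
... | inj₁ lt = inj₁ (trans (FP.toℕ-fromℕ< _) (m<n⇒m%n≡m lt))
... | inj₂ eq = inj₂ (trans (FP.toℕ-fromℕ< _) (trans (cong (_% suc k) eq) (n%n≡0 (suc k))) , eq)

next-injective : ∀ {n} {a b : Fin n} → next a ≡ next b → a ≡ b
next-injective {a = a} {b} eq with toℕ-next a | toℕ-next b
... | inj₁ p | inj₁ q = FP.toℕ-injective (suc-injective (trans (sym p) (trans (cong toℕ eq) q)))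
... | inj₁ p | inj₂ (q , _) with () ← trans (sym p) (trans (cong toℕ eq) q)
... | inj₂ (p , _) | inj₁ q with () ← trans (sym q) (trans (cong toℕ (sym eq)) p)
... | inj₂ (_ , p) | inj₂ (_ , q) = FP.toℕ-injective (suc-injective (trans p (sym q)))

next-irreflexive : ∀ {n} → 2 ≤ n → (i : Fin n) → next i ≢ i
next-irreflexive 2≤n i eq with toℕ-next i
... | inj₁ p = 1+n≢n (trans (sym p) (cong toℕ eq))
... | inj₂ (p , q) with toℕ i | trans (sym (cong toℕ eq)) p
... | .0 | refl with s≤s () ← ≤-trans 2≤n (≤-reflexive (sym q))

walk : ∀ {n} → ℕ → Fin n → Fin n
walk zero x = x
walk (suc k) x = next (walk k x)

toℕ-walk : ∀ {n} d (x : Fin n) → d < n →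
  toℕ (walk d x) ≡ toℕ x + d ⊎ toℕ (walk d x) + n ≡ toℕ x + d
toℕ-walk zero x _ = inj₁ (sym (+-identityʳ _))
toℕ-walk {n} (suc d) x sd<n with toℕ-walk d x (<-trans (n<1+n d) sd<n) | toℕ-next (walk d x)
... | inj₁ r | inj₁ p = inj₁ (trans p (trans (cong suc r) (sym (+-suc _ d))))
... | inj₂ r | inj₁ p = inj₂ (trans (cong (_+ n) p) (trans (cong suc r) (sym (+-suc _ d))))
... | inj₁ r | inj₂ (p , q) = inj₂ (trans (cong (_+ n) p) (trans (sym q) (trans (cong suc r) (sym (+-suc _ d)))))
... | inj₂ r | inj₂ (p , q) = ⊥-elim (<-irrefl refl (begin-strict
      toℕ x + d           <⟨ +-mono-<-≤ (FP.toℕ<n x) (≤-refl {d}) ⟩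
      n + d               ≤⟨ +-monoʳ-≤ n (≤-trans (n≤1+n d) (s≤s⁻¹ (≤-trans sd<n (≤-reflexive (sym q))))) ⟩
      n + toℕ (walk d x)  ≡⟨ +-comm n _ ⟩
      toℕ (walk d x) + n  ≡⟨ r ⟩
      toℕ x + d           ∎))
  where open ≤-Reasoning

walk-not-closed : ∀ {n} d (x : Fin n) → 0 < d → d < n → walk d x ≢ x
walk-not-closed {n} d x 0<d d<n eq with toℕ-walk d x d<n
... | inj₁ p = <-irrefl refl (subst (_< toℕ x + d) (trans (sym (cong toℕ eq)) p) (m<m+n (toℕ x) 0<d))
... | inj₂ p = <-irrefl refl
      (subst (_< n) (+-cancelˡ-≡ (toℕ x) _ _ (trans (sym p) (cong (_+ n) (cong toℕ eq)))) d<n)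

walk-distinct : ∀ {n} i j (x : Fin n) → i < j → j < n → walk i x ≢ walk j x
walk-distinct zero j x i<j j<n eq = walk-not-closed j x i<j j<n (sym eq)
walk-distinct (suc i) (suc j) x (s≤s i<j) j<n eq =
  walk-distinct i j x i<j (<-trans (n<1+n j) j<n) (next-injective eq)

update-same : ∀ {n} (f : Labeling n) v l → update f v l v ≡ just l
update-same f v l with v F.≟ v
... | yes _ = refl
... | no v≢v = ⊥-elim (v≢v refl)

update-other : ∀ {n} (f : Labeling n) v l w → w ≢ v → update f v l w ≡ f w
update-other f v l w w≢v with w F.≟ v
... | yes w≡v = ⊥-elim (w≢v w≡v)
... | no _ = refl

update-keeps : ∀ {n} (f : Labeling n) v l w {c} → w ≢ v → f w ≡ just c → update f v l w ≡ just c
update-keeps f v l w w≢v fw = trans (update-other f v l w w≢v) fw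

update-cases : ∀ {n} (f : Labeling n) v l w {c} → update f v l w ≡ just c →
  (w ≡ v × l ≡ c) ⊎ (w ≢ v × f w ≡ just c)
update-cases f v l w eq with w F.≟ v
... | yes w≡v with refl ← eq = inj₁ (w≡v , refl)
... | no w≢v = inj₂ (w≢v , eq)

edgeOf : Maybe ℕ → Maybe ℕ → Maybe ℕ
edgeOf (just a) (just b) = just ∣ a - b ∣
edgeOf _ _ = nothing

edgeLabel-edgeOf : ∀ {n} (g : Labeling n) i → edgeLabel g i ≡ edgeOf (g i) (g (next i))
edgeLabel-edgeOf g i with g i | g (next i)
... | just a  | just b  = refl
... | just a  | nothing = refl
... | nothing | just b  = refl
... | nothing | nothing = refl

edgeOf-just : ∀ {x y e} → edgeOf x y ≡ just e →
  Σ ℕ λ a → Σ ℕ λ b → x ≡ just a × y ≡ just b × ∣ a - b ∣ ≡ e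
edgeOf-just {just a} {just b} refl = a , b , refl , refl , refl

edge-endpoints : ∀ {n} (g : Labeling n) i {e} → edgeLabel g i ≡ just e →
  Σ ℕ λ a → Σ ℕ λ b → g i ≡ just a × g (next i) ≡ just b × ∣ a - b ∣ ≡ e
edge-endpoints g i eq = edgeOf-just (trans (sym (edgeLabel-edgeOf g i)) eq)

edge-from-endpoints : ∀ {n} (g : Labeling n) i {a b} → g i ≡ just a → g (next i) ≡ just b →
  edgeLabel g i ≡ just ∣ a - b ∣
edge-from-endpoints g i ga gb = trans (edgeLabel-edgeOf g i) (cong₂ edgeOf ga gb)

Bounded : ∀ {n} → Labeling n → Set
Bounded {n} f = ∀ v l → f v ≡ just l → l ≤ n

-- Invariant of every position reached by legal play.
record Valid {n} (f : Labeling n) : Set where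
  field
    injective : ∀ v w l → f v ≡ just l → f w ≡ just l → v ≡ w
    bounded   : Bounded f
    distinct  : EdgeLabelsDistinct f

valid-empty : ∀ {n} → Valid {n} emptyLabeling
valid-empty = record { injective = λ _ _ _ () ; bounded = λ _ _ () ; distinct = λ _ _ _ _ _ () }

bounded-update : ∀ {n} {f : Labeling n} → Bounded f → ∀ v l → l ≤ n → Bounded (update f v l)
bounded-update {f = f} bnd v l l≤n w m eq with update-cases f v l w eq
... | inj₁ (_ , refl) = l≤n
... | inj₂ (_ , fw) = bnd w m fw

valid-move : ∀ {n} {f : Labeling n} {v l} → Valid f → Legal f v l → Valid (update f v l)
valid-move {f = f} {v} {l} valid (_ , l≤n , unused , edges-distinct) = record
  { injective = injective ; bounded = bounded ; distinct = edges-distinct }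
  where
  open Valid valid renaming (injective to inj; bounded to bnd)
  injective : ∀ a b m → update f v l a ≡ just m → update f v l b ≡ just m → a ≡ b
  injective a b m p q with update-cases f v l a p | update-cases f v l b q
  ... | inj₁ (a≡v , _) | inj₁ (b≡v , _) = trans a≡v (sym b≡v)
  ... | inj₁ (_ , refl) | inj₂ (_ , fb) = ⊥-elim (unused b fb)
  ... | inj₂ (_ , fa) | inj₁ (_ , refl) = ⊥-elim (unused a fa)
  ... | inj₂ (_ , fa) | inj₂ (_ , fb) = inj a b m fa fb
  bounded : Bounded (update f v l)
  bounded = bounded-update bnd v l l≤n

Extends : ∀ {n} → Labeling n → Labeling n → Set
Extends f g = ∀ v l → f v ≡ just l → g v ≡ just l

extends-refl : ∀ {n} (f : Labeling n) → Extends f f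
extends-refl f _ _ p = p

extends-trans : ∀ {n} {f g h : Labeling n} → Extends f g → Extends g h → Extends f h
extends-trans f⊑g g⊑h v l p = g⊑h v l (f⊑g v l p)

extends-update : ∀ {n} (f : Labeling n) v l → f v ≡ nothing → Extends f (update f v l)
extends-update f v l fv w m fw = update-keeps f v l w w≢v fw
  where
  w≢v : w ≢ v
  w≢v refl with () ← trans (sym fv) fw

edge-label-range : ∀ {n} → 2 ≤ n → (g : Labeling n) → Full g → Valid g →
  ∀ i → Σ ℕ λ e → edgeLabel g i ≡ just (suc e) × e < n
edge-label-range {n} 2≤n g full valid i with full i | full (next i)
... | a , ga | b , gb with ∣ a - b ∣ in a-b
... | zero = ⊥-elim (next-irreflexive 2≤n i (sym (injective i (next i) a ga
               (trans gb (cong just (sym (∣m-n∣≡0⇒m≡n a-b)))))))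
  where open Valid valid
... | suc e = e , trans (edge-from-endpoints g i ga gb) (cong just a-b) ,
               subst (_≤ n) a-b (≤-trans (∣m-n∣≤m⊔n a b) (⊔-lub (bounded i a ga) (bounded (next i) b gb)))
  where open Valid valid

-- Pigeonhole: the n distinct edge labels of a complete valid labeling fill
-- {1,…,n}, so no label k in that range can be missing.
no-missing-label : ∀ {n} → 2 ≤ n → ∀ {k} → 1 ≤ k → k ≤ n → (g : Labeling n) →
  Full g → Valid g → (∀ i → edgeLabel g i ≢ just k) → ⊥
no-missing-label {suc m} 2≤n {suc k} _ k≤n g full valid missing = collision
  where
  label : Fin (suc m) → ℕ
  label i = proj₁ (edge-label-range 2≤n g full valid i)
  label-eq : ∀ i → edgeLabel g i ≡ just (suc (label i))
  label-eq i = proj₁ (proj₂ (edge-label-range 2≤n g full valid i))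
  code : Fin (suc m) → Fin (suc m)
  code i = fromℕ< (proj₂ (proj₂ (edge-label-range 2≤n g full valid i)))
  code-toℕ : ∀ i → toℕ (code i) ≡ label i
  code-toℕ i = FP.toℕ-fromℕ< _
  k′ : Fin (suc m)
  k′ = fromℕ< k≤n
  k′≢code : ∀ i → k′ ≢ code i
  k′≢code i eq = missing i (trans (label-eq i) (cong (λ z → just (suc z))
    (trans (sym (code-toℕ i)) (trans (cong toℕ (sym eq)) (FP.toℕ-fromℕ< k≤n)))))
  collision : ⊥
  collision with FP.pigeonhole ≤-refl (λ i → punchOut (k′≢code i))
  ... | i , j , i<j , same = Valid.distinct valid i j _ _ (FP.<⇒≢ i<j) (label-eq i) (label-eq j)
      (cong suc (trans (sym (code-toℕ i))
        (trans (cong toℕ (FP.punchOut-injective (k′≢code i) (k′≢code j) same)) (code-toℕ j))))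

edge-untouched : ∀ {n} (f : Labeling n) v l i → i ≢ v → next i ≢ v →
  edgeLabel (update f v l) i ≡ edgeLabel f i
edge-untouched f v l i i≢v next-i≢v = begin
  edgeLabel (update f v l) i                       ≡⟨ edgeLabel-edgeOf (update f v l) i ⟩
  edgeOf (update f v l i) (update f v l (next i))  ≡⟨ cong₂ edgeOf (update-other f v l i i≢v)
                                                               (update-other f v l (next i) next-i≢v) ⟩
  edgeOf (f i) (f (next i))                        ≡⟨ edgeLabel-edgeOf f i ⟨
  edgeLabel f i                                    ∎
  where open ≡-Reasoning

Compatible : Maybe ℕ → Maybe ℕ → Set
Compatible (just a) (just b) = a ≢ b
Compatible _        _        = ⊤

compatible? : ∀ x y → Dec (Compatible x y)
compatible? (just a) (just b)  = ¬? (a ≟ b)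
compatible? (just a) nothing   = yes tt
compatible? nothing  (just b)  = yes tt
compatible? nothing  nothing   = yes tt

LocallyDistinct : ∀ {n} → Labeling n → Fin n → Set
LocallyDistinct {n} g v = ∀ (i : Fin n) → i ≡ v ⊎ next i ≡ v →
  ∀ j → i ≢ j → Compatible (edgeLabel g i) (edgeLabel g j)

locally-distinct? : ∀ {n} (g : Labeling n) v → Dec (LocallyDistinct g v)
locally-distinct? g v = FP.all? λ i → ((i F.≟ v) ⊎-dec (next i F.≟ v)) →-dec
  FP.all? λ j → ¬? (i F.≟ j) →-dec compatible? (edgeLabel g i) (edgeLabel g j)

distinct⇒locally : ∀ {n} (g : Labeling n) v → EdgeLabelsDistinct g → LocallyDistinct g v
distinct⇒locally g v distinct i _ j i≢j with edgeLabel g i in ei | edgeLabel g j in ej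
... | just a  | just b  = distinct i j a b i≢j ei ej
... | just a  | nothing = tt
... | nothing | just b  = tt
... | nothing | nothing = tt

-- A move only creates edges at v, so checking those edges suffices.
locally⇒distinct : ∀ {n} (f : Labeling n) v l → EdgeLabelsDistinct f →
  LocallyDistinct (update f v l) v → EdgeLabelsDistinct (update f v l)
locally⇒distinct f v l distinct local i j a b i≢j ei ej = by-cases (touches? i) (touches? j)
  where
  touches? : ∀ k → Dec (k ≡ v ⊎ next k ≡ v)
  touches? k = (k F.≟ v) ⊎-dec (next k F.≟ v)
  untouched : ∀ k → ¬ (k ≡ v ⊎ next k ≡ v) → edgeLabel (update f v l) k ≡ edgeLabel f k
  untouched k away = edge-untouched f v l k (λ e → away (inj₁ e)) (λ e → away (inj₂ e))
  by-cases : Dec (i ≡ v ⊎ next i ≡ v) → Dec (j ≡ v ⊎ next j ≡ v) → a ≢ b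
  by-cases (yes ti) _ = subst₂ Compatible ei ej (local i ti j i≢j)
  by-cases (no _) (yes tj) = λ a≡b → subst₂ Compatible ej ei (local j tj i (≢-sym i≢j)) (sym a≡b)
  by-cases (no ti) (no tj) =
    distinct i j a b i≢j (trans (sym (untouched i ti)) ei) (trans (sym (untouched j tj)) ej)

legal? : ∀ {n} (f : Labeling n) → EdgeLabelsDistinct f → ∀ v l → Dec (Legal f v l)
legal? {n} f distinct v l =
  MP.≡-dec _≟_ (f v) nothing ×-dec l ≤? n ×-dec
  FP.all? (λ w → ¬? (MP.≡-dec _≟_ (f w) (just l))) ×-dec
  map′ (locally⇒distinct f v l distinct) (distinct⇒locally _ v) (locally-distinct? (update f v l) v)

-- Some legal move exists; it suffices to try the labels 0,…,n.
move? : ∀ {n} (f : Labeling n) → EdgeLabelsDistinct f →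
  Dec (Σ (Fin n) λ v → Σ ℕ λ l → Legal f v l)
move? {n} f distinct = map′
  (λ (v , l , legal) → v , toℕ l , legal)
  (λ (v , l , legal@(_ , l≤n , _)) → v , fromℕ< (s≤s l≤n) ,
     subst (Legal f v) (sym (FP.toℕ-fromℕ< (s≤s l≤n))) legal)
  (FP.any? λ v → FP.any? λ (l : Fin (suc n)) → legal? f distinct v (toℕ l))

full? : ∀ {n} (f : Labeling n) → Dec (Full f)
full? f = FP.all? (λ v → labeled? (f v))
  where
  labeled? : (x : Maybe ℕ) → Dec (∃ λ l → x ≡ just l)
  labeled? (just l) = yes (l , refl)
  labeled? nothing  = no λ ()

Dead : ∀ {n} → Labeling n → ℕ → Set
Dead f k = ∀ g → Extends f g → Full g → Valid g → ∀ i → edgeLabel g i ≢ just k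

dead-extends : ∀ {n} {f f′ : Labeling n} {k} → Extends f f′ → Dead f k → Dead f′ k
dead-extends f⊑f′ dead g f′⊑g = dead g (extends-trans f⊑f′ f′⊑g)

-- The number of free vertices; it decreases with every move.
unlabeled : Maybe ℕ → ℕ
unlabeled nothing  = 1
unlabeled (just _) = 0

freeCount : ∀ {n} → Labeling n → ℕ
freeCount {zero}  f = 0
freeCount {suc n} f = unlabeled (f fz) + freeCount (λ i → f (fs i))

freeCount-agree : ∀ {n} (f g : Labeling n) → (∀ w → g w ≡ f w) → freeCount g ≡ freeCount f
freeCount-agree {zero}  f g g≗f = refl
freeCount-agree {suc n} f g g≗f rewrite g≗f fz =
  cong (unlabeled (f fz) +_) (freeCount-agree (λ i → f (fs i)) (λ i → g (fs i)) (λ i → g≗f (fs i)))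

freeCount-fill : ∀ {n} (f g : Labeling n) v {l} → f v ≡ nothing → g v ≡ just l →
  (∀ w → w ≢ v → g w ≡ f w) → freeCount g < freeCount f
freeCount-fill {suc n} f g fz fv gv rest rewrite fv | gv =
  s≤s (≤-reflexive (freeCount-agree (λ i → f (fs i)) (λ i → g (fs i)) (λ i → rest (fs i) λ ())))
freeCount-fill {suc n} f g (fs v) fv gv rest rewrite rest fz (λ ()) =
  +-monoʳ-< _ (freeCount-fill (λ i → f (fs i)) (λ i → g (fs i)) v fv gv
                 (λ w w≢v → rest (fs w) (λ e → w≢v (FP.suc-injective e))))

freeCount-update : ∀ {n} (f : Labeling n) v l → f v ≡ nothing → freeCount (update f v l) < freeCount f
freeCount-update f v l fv = freeCount-fill f (update f v l) v fv (update-same f v l) (update-other f v l)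

bob-wins-by-all-moves : ∀ {n} p (f : Labeling n) → Valid f → ¬ Full f →
  (∀ {p′} v l → Legal f v l → BobWins p′ (update f v l)) → BobWins p f
bob-wins-by-all-moves alice f valid incomplete continue = alice-turn incomplete continue
bob-wins-by-all-moves bob f valid incomplete continue with move? f (Valid.distinct valid)
... | yes (v , l , legal) = bob-turn v l legal (continue v l legal)
... | no stuck′ = stuck incomplete (λ v l legal → stuck′ (v , l , legal))

-- Main endgame principle: once some label k ∈ {1,…,n} is dead, Bob wins.
-- By the pigeonhole principle the labeling can never become complete, and
-- deadness persists under every move.
dead-label-wins : ∀ {n} → 2 ≤ n → ∀ {k} → 1 ≤ k → k ≤ n →
  ∀ p (f : Labeling n) → Valid f → Dead f k → BobWins p f
dead-label-wins {n} 2≤n {k} 1≤k k≤n p f = play (suc (freeCount f)) p f ≤-refl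
  where
  play : ∀ m p (f : Labeling n) → freeCount f < m → Valid f → Dead f k → BobWins p f
  play (suc m) p f (s≤s fuel) valid dead = bob-wins-by-all-moves p f valid incomplete continue
    where
    incomplete : ¬ Full f
    incomplete full = no-missing-label 2≤n 1≤k k≤n f full valid (dead f (extends-refl f) full valid)
    continue : ∀ {p′} v l → Legal f v l → BobWins p′ (update f v l)
    continue v l legal = play m _ (update f v l) (≤-trans (freeCount-update f v l (proj₁ legal)) fuel)
      (valid-move valid legal) (dead-extends (extends-update f v l (proj₁ legal)) dead)

dead-after-move-wins : ∀ {n} → 2 ≤ n → ∀ {k} → 1 ≤ k → k ≤ n → {f : Labeling n} → Valid f →
  ∀ w c (legal : Legal f w c) → Dead (update f w c) k → BobWins bob f
dead-after-move-wins 2≤n 1≤k k≤n valid w c legal dead =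
  bob-turn w c legal (dead-label-wins 2≤n 1≤k k≤n alice _ (valid-move valid legal) dead)

distance-cases : ∀ a b {k} → ∣ a - b ∣ ≡ k → b ≡ a + k ⊎ a ≡ b + k
distance-cases zero    b       refl = inj₁ refl
distance-cases (suc a) zero    refl = inj₂ refl
distance-cases (suc a) (suc b) eq with distance-cases a b eq
... | inj₁ p = inj₁ (cong suc p)
... | inj₂ p = inj₂ (cong suc p)

Joins : ∀ {n} → Labeling n → Fin n → ℕ → ℕ → Set
Joins g i L M = (g i ≡ just L × g (next i) ≡ just M) ⊎ (g i ≡ just M × g (next i) ≡ just L)

edge-joins : ∀ {n} {g : Labeling n} → Valid g → ∀ i {k} → edgeLabel g i ≡ just k →
  Σ ℕ λ a → a + k ≤ n × Joins g i a (a + k)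
edge-joins {g = g} valid i eq with edge-endpoints g i eq
... | a , b , ga , gb , a-b with distance-cases a b a-b
... | inj₁ refl = a , Valid.bounded valid (next i) _ gb , inj₁ (ga , gb)
... | inj₂ refl = b , Valid.bounded valid i _ ga , inj₂ (ga , gb)

CanHold : ∀ {n} → Labeling n → Fin n → ℕ → Set
CanHold f x c = f x ≡ just c ⊎ (f x ≡ nothing × ∀ w → f w ≢ just c)

can-hold? : ∀ {n} (f : Labeling n) x c → Dec (CanHold f x c)
can-hold? f x c = MP.≡-dec _≟_ (f x) (just c) ⊎-dec
  (MP.≡-dec _≟_ (f x) nothing ×-dec FP.all? (λ w → ¬? (MP.≡-dec _≟_ (f w) (just c))))

held-in-extension : ∀ {n} {f g : Labeling n} → Extends f g → Valid g →
  ∀ {x c} → g x ≡ just c → CanHold f x c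
held-in-extension {f = f} f⊑g valid {x} {c} gx with f x in fx
... | just d = inj₁ (trans (sym (f⊑g x d fx)) gx)
... | nothing = inj₂ (refl , unused)
  where
  unused : ∀ w → f w ≢ just c
  unused w fw with Valid.injective valid w x c (f⊑g w c fw) gx
  ... | refl with () ← trans (sym fx) fw

CanReceive : ∀ {n} → Labeling n → ℕ → Fin n → ℕ → Set
CanReceive f k i a =
  (CanHold f i a × CanHold f (next i) (a + k)) ⊎ (CanHold f i (a + k) × CanHold f (next i) a)

-- Label k is alive at f if some edge can still receive a pair at distance k
-- (the smaller label a satisfies a + k ≤ n, so a ranges over a finite set).
Alive : ∀ {n} → Labeling n → ℕ → Set
Alive {n} f k = Σ (Fin n) λ i → Σ (Fin (suc (n ∸ k))) λ a → CanReceive f k i (toℕ a)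

alive? : ∀ {n} (f : Labeling n) k → Dec (Alive f k)
alive? f k = FP.any? λ i → FP.any? λ a →
  (can-hold? f i (toℕ a) ×-dec can-hold? f (next i) (toℕ a + k)) ⊎-dec
  (can-hold? f i (toℕ a + k) ×-dec can-hold? f (next i) (toℕ a))

alive-at : ∀ {n} (f : Labeling n) k i a → a + k ≤ n → CanReceive f k i a → Alive f k
alive-at {n} f k i a a+k≤n can = i , fromℕ< a<1+n∸k ,
  subst (CanReceive f k i) (sym (FP.toℕ-fromℕ< a<1+n∸k)) can
  where
  a<1+n∸k : a < suc (n ∸ k)
  a<1+n∸k = s≤s (subst (_≤ n ∸ k) (m+n∸n≡m a k) (∸-monoˡ-≤ k a+k≤n))

not-alive⇒dead : ∀ {n} (f : Labeling n) k → ¬ Alive f k → Dead f k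
not-alive⇒dead f k not-alive g f⊑g _ valid i eq with edge-joins valid i eq
... | a , a+k≤n , joins = not-alive (alive-at f k i a a+k≤n (receive joins))
  where
  hold : ∀ {x c} → g x ≡ just c → CanHold f x c
  hold = held-in-extension f⊑g valid
  receive : Joins g i a (a + k) → CanReceive f k i a
  receive (inj₁ (ga , gb)) = inj₁ (hold ga , hold gb)
  receive (inj₂ (ga , gb)) = inj₂ (hold ga , hold gb)

Separated : ∀ {n} → Labeling n → ℕ → ℕ → Set
Separated f L M = ∀ g → Extends f g → Valid g → ∀ i → ¬ Joins g i L M

separated-sym : ∀ {n} {f : Labeling n} {L M} → Separated f L M → Separated f M L
separated-sym sep g f⊑g valid i (inj₁ h) = sep g f⊑g valid i (inj₂ h)
separated-sym sep g f⊑g valid i (inj₂ h) = sep g f⊑g valid i (inj₁ h)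

separated-apart : ∀ {n} (f : Labeling n) {L M p q} → f p ≡ just L → f q ≡ just M →
  next p ≢ q → next q ≢ p → Separated f L M
separated-apart f {L} {M} {p} {q} fp fq p↛q q↛p g f⊑g valid i (inj₁ (gi , gn))
  with injective i p L gi (f⊑g p L fp) | injective (next i) q M gn (f⊑g q M fq)
  where open Valid valid
... | refl | refl = p↛q refl
separated-apart f {L} {M} {p} {q} fp fq p↛q q↛p g f⊑g valid i (inj₂ (gi , gn))
  with injective i q M gi (f⊑g q M fq) | injective (next i) p L gn (f⊑g p L fp)
  where open Valid valid
... | refl | refl = q↛p refl

separated-surrounded : ∀ {n} (f : Labeling n) {L M p u c c′} → f p ≡ just L → next u ≡ p →
  f (next p) ≡ just c → f u ≡ just c′ → c ≢ M → c′ ≢ M → Separated f L M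
separated-surrounded f {L} {M} {p} {u} {c} {c′} fp u→p fc fc′ c≢M c′≢M g f⊑g valid i (inj₁ (gi , gn))
  with Valid.injective valid i p L gi (f⊑g p L fp)
... | refl = c≢M (just-injective (trans (sym (f⊑g (next i) c fc)) gn))
separated-surrounded f {L} {M} {p} {u} {c} {c′} fp u→p fc fc′ c≢M c′≢M g f⊑g valid i (inj₂ (gi , gn))
  with next-injective (trans (Valid.injective valid (next i) p L gn (f⊑g p L fp)) (sym u→p))
... | refl = c′≢M (just-injective (trans (sym (f⊑g i c′ fc′)) gi))

-- The top label n can only arise from the pair {0, n}.
dead-top : ∀ {n} (f : Labeling n) → Separated f 0 n → Dead f n
dead-top {n} f sep g f⊑g _ valid i eq with edge-joins valid i eq
... | a , a+n≤n , joins with n≤0⇒n≡0 (+-cancelʳ-≤ n a 0 a+n≤n)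
... | refl = sep g f⊑g valid i joins

-- The label n − 1 (for n = 1 + m) only arises from {0, n − 1} or {1, n}.
dead-second : ∀ {m} (f : Labeling (suc m)) → Separated f 0 m → Separated f 1 (suc m) → Dead f m
dead-second {m} f sep₀ sep₁ g f⊑g _ valid i eq with edge-joins valid i eq
... | a , a+m≤1+m , joins with n≤1⇒n≡0∨n≡1 (+-cancelʳ-≤ m a 1 a+m≤1+m)
... | inj₁ refl = sep₀ g f⊑g valid i joins
... | inj₂ refl = sep₁ g f⊑g valid i joins

distinct-with-new-edge : ∀ {n} (f f′ : Labeling n) s {d} → EdgeLabelsDistinct f →
  edgeLabel f′ s ≡ just d → (∀ i → i ≢ s → ∀ {e} → edgeLabel f′ i ≡ just e → edgeLabel f i ≡ just e) →
  (∀ j {e} → edgeLabel f j ≡ just e → e ≢ d) → EdgeLabelsDistinct f′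
distinct-with-new-edge f f′ s distinct new old fresh i j a b i≢j ei ej with i F.≟ s | j F.≟ s
... | yes refl | yes refl = ⊥-elim (i≢j refl)
... | yes refl | no j≢s with refl ← trans (sym ei) new = λ d≡b → fresh j (old j j≢s ej) (sym d≡b)
... | no i≢s | yes refl with refl ← trans (sym ej) new = fresh i (old i i≢s ei)
... | no i≢s | no j≢s = distinct i j a b i≢j (old i i≢s ei) (old j j≢s ej)

unlabeled-free-tail : ∀ {n} (f : Labeling n) w c i → f i ≡ nothing → i ≢ w →
  edgeLabel (update f w c) i ≡ nothing
unlabeled-free-tail f w c i fi i≢w =
  trans (edgeLabel-edgeOf (update f w c) i)
    (cong (λ x → edgeOf x (update f w c (next i))) (trans (update-other f w c i i≢w) fi))

unlabeled-free-head : ∀ {n} (f : Labeling n) w c i → f (next i) ≡ nothing → next i ≢ w →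
  edgeLabel (update f w c) i ≡ nothing
unlabeled-free-head f w c i fi i≢w =
  trans (edgeLabel-edgeOf (update f w c) i)
    (trans (cong (edgeOf (update f w c i)) (trans (update-other f w c (next i) i≢w) fi))
    (no-head (update f w c i)))
  where
  no-head : ∀ x → edgeOf x nothing ≡ nothing
  no-head (just _) = refl
  no-head nothing  = refl

FreshLabel : ∀ {n} → Labeling n → Fin n → ℕ → Set
FreshLabel {n} f w c = f w ≡ nothing × c ≤ n × (∀ z → f z ≢ just c)

legal-isolated : ∀ {n} → 2 ≤ n → {f : Labeling n} {w : Fin n} {c : ℕ} → Valid f →
  FreshLabel f w c → (∀ u → next u ≡ w → f u ≡ nothing) → f (next w) ≡ nothing → Legal f w c
legal-isolated 2≤n {f} {w} {c} valid (fw , c≤n , unused) pred-free succ-free =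
  fw , c≤n , unused , λ i j a b i≢j ei ej → Valid.distinct valid i j a b i≢j (old i ei) (old j ej)
  where
  old : ∀ i {e} → edgeLabel (update f w c) i ≡ just e → edgeLabel f i ≡ just e
  old i {e} eq = by-cases (i F.≟ w) (next i F.≟ w)
    where
    by-cases : Dec (i ≡ w) → Dec (next i ≡ w) → edgeLabel f i ≡ just e
    by-cases (yes refl) _ with () ← trans (sym eq) (unlabeled-free-head f w c i succ-free (next-irreflexive 2≤n i))
    by-cases (no i≢w) (yes i→w) with () ← trans (sym eq) (unlabeled-free-tail f w c i (pred-free i i→w) i≢w)
    by-cases (no i≢w) (no i↛w) = trans (sym (edge-untouched f w c i i≢w i↛w)) eq

legal-after : ∀ {n} → 2 ≤ n → {f : Labeling n} {w u : Fin n} {c d : ℕ} → Valid f →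
  FreshLabel f w c → next u ≡ w → f (next w) ≡ nothing →
  edgeLabel (update f w c) u ≡ just d → (∀ j {e} → edgeLabel f j ≡ just e → e ≢ d) → Legal f w c
legal-after 2≤n {f} {w} {u} {c} valid (fw , c≤n , unused) u→w succ-free new fresh =
  fw , c≤n , unused , distinct-with-new-edge f (update f w c) u (Valid.distinct valid) new old fresh
  where
  old : ∀ i → i ≢ u → ∀ {e} → edgeLabel (update f w c) i ≡ just e → edgeLabel f i ≡ just e
  old i i≢u {e} eq = by-cases (i F.≟ w) (next i F.≟ w)
    where
    by-cases : Dec (i ≡ w) → Dec (next i ≡ w) → edgeLabel f i ≡ just e
    by-cases (yes refl) _ with () ← trans (sym eq) (unlabeled-free-head f w c i succ-free (next-irreflexive 2≤n i))
    by-cases (no i≢w) (yes i→w) = ⊥-elim (i≢u (next-injective (trans i→w (sym u→w))))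
    by-cases (no i≢w) (no i↛w) = trans (sym (edge-untouched f w c i i≢w i↛w)) eq

legal-before : ∀ {n} {f : Labeling n} {w : Fin n} {c d : ℕ} → Valid f →
  FreshLabel f w c → (∀ u → next u ≡ w → f u ≡ nothing) →
  edgeLabel (update f w c) w ≡ just d → (∀ j {e} → edgeLabel f j ≡ just e → e ≢ d) → Legal f w c
legal-before {f = f} {w} {c} valid (fw , c≤n , unused) pred-free new fresh =
  fw , c≤n , unused , distinct-with-new-edge f (update f w c) w (Valid.distinct valid) new old fresh
  where
  old : ∀ i → i ≢ w → ∀ {e} → edgeLabel (update f w c) i ≡ just e → edgeLabel f i ≡ just e
  old i i≢w {e} eq = by-cases (next i F.≟ w)
    where
    by-cases : Dec (next i ≡ w) → edgeLabel f i ≡ just e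
    by-cases (yes i→w) with () ← trans (sym eq) (unlabeled-free-tail f w c i (pred-free i i→w) i≢w)
    by-cases (no i↛w) = trans (sym (edge-untouched f w c i i≢w i↛w)) eq

-- The symmetry l ↦ n ∸ l of the label set {0,…,n} preserves all distances,
-- so it maps graceful labelings to graceful labelings and strategies to
-- strategies.
complement : ℕ → Maybe ℕ → Maybe ℕ
complement n (just l) = just (n ∸ l)
complement n nothing  = nothing

complement-distance : ∀ {n a b} → a ≤ n → b ≤ n → ∣ n ∸ a - n ∸ b ∣ ≡ ∣ a - b ∣
complement-distance {n} {a} {b} a≤n b≤n = begin
  ∣ x - y ∣                       ≡⟨ ∣-∣-comm x y ⟩
  ∣ y - x ∣                       ≡⟨ ∣m+n-m+o∣≡∣n-o∣ n y x ⟨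
  ∣ n + y - n + x ∣               ≡⟨ cong₂ ∣_-_∣ n+y n+x ⟩
  ∣ (x + y) + a - (x + y) + b ∣   ≡⟨ ∣m+n-m+o∣≡∣n-o∣ (x + y) a b ⟩
  ∣ a - b ∣                       ∎
  where
  open ≡-Reasoning
  x = n ∸ a
  y = n ∸ b
  n+y : n + y ≡ (x + y) + a
  n+y = begin
    n + y        ≡⟨ cong (_+ y) (m∸n+n≡m a≤n) ⟨
    x + a + y    ≡⟨ +-assoc x a y ⟩
    x + (a + y)  ≡⟨ cong (x +_) (+-comm a y) ⟩
    x + (y + a)  ≡⟨ +-assoc x y a ⟨
    x + y + a    ∎
  n+x : n + x ≡ (x + y) + b
  n+x = begin
    n + x        ≡⟨ cong (_+ x) (m∸n+n≡m b≤n) ⟨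
    y + b + x    ≡⟨ +-comm (y + b) x ⟩
    x + (y + b)  ≡⟨ +-assoc x y b ⟨
    x + y + b    ∎

Mirrors : ∀ {n} → Labeling n → Labeling n → Set
Mirrors {n} F G = ∀ z → F z ≡ complement n (G z)

mirrors-bounded : ∀ {n} {F G : Labeling n} → Mirrors F G → Bounded F
mirrors-bounded {n} {F} {G} F~G z l eq with G z in gz
... | just a with refl ← trans (trans (sym eq) (F~G z)) (cong (complement n) gz) = m∸n≤m n a
... | nothing with () ← trans (trans (sym eq) (F~G z)) (cong (complement n) gz)

mirrors-sym : ∀ {n} {F G : Labeling n} → Bounded G → Mirrors F G → Mirrors G F
mirrors-sym {n} {F} {G} bnd F~G z with G z in gz
... | nothing = cong (complement n) (trans (sym (cong (complement n) gz)) (sym (F~G z)))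
... | just a = trans (cong just (sym (m∸[m∸n]≡n (bnd z a gz))))
                (cong (complement n) (trans (sym (cong (complement n) gz)) (sym (F~G z))))

mirrors-update : ∀ {n} {F G : Labeling n} → Mirrors F G → ∀ v c d → just c ≡ complement n (just d) →
  Mirrors (update F v c) (update G v d)
mirrors-update F~G v c d eq z with z F.≟ v
... | yes _ = eq
... | no _ = F~G z

mirrors-full : ∀ {n} {F G : Labeling n} → Mirrors F G → Full F → Full G
mirrors-full {n} {F} {G} F~G full z with full z | G z in gz
... | _ , _  | just a = a , refl
... | l , f-z | nothing with () ← trans (trans (sym f-z) (F~G z)) (cong (complement n) gz)

mirrors-edges : ∀ {n} {F G : Labeling n} → Mirrors F G → Bounded G → ∀ i → edgeLabel F i ≡ edgeLabel G i
mirrors-edges {n} {F} {G} F~G bnd i = begin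
  edgeLabel F i                                               ≡⟨ edgeLabel-edgeOf F i ⟩
  edgeOf (F i) (F (next i))                                   ≡⟨ cong₂ edgeOf (F~G i) (F~G (next i)) ⟩
  edgeOf (complement n (G i)) (complement n (G (next i)))     ≡⟨ same (G i) (G (next i)) refl refl ⟩
  edgeOf (G i) (G (next i))                                   ≡⟨ edgeLabel-edgeOf G i ⟨
  edgeLabel G i                                               ∎
  where
  open ≡-Reasoning
  same : ∀ p q → G i ≡ p → G (next i) ≡ q → edgeOf (complement n p) (complement n q) ≡ edgeOf p q
  same (just a) (just b) ga gb = cong just (complement-distance (bnd i a ga) (bnd (next i) b gb))
  same (just a) nothing  _ _ = refl
  same nothing  (just b) _ _ = refl
  same nothing  nothing  _ _ = refl

mirrors-legal : ∀ {n} {F G : Labeling n} → Mirrors F G → Bounded G → ∀ {v l} →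
  Legal G v l → Legal F v (n ∸ l)
mirrors-legal {n} {F} {G} F~G bnd {v} {l} (gv , l≤n , unused , distinct) =
  trans (F~G v) (cong (complement n) gv) , m∸n≤m n l , unused′ , distinct′
  where
  F′~G′ : Mirrors (update F v (n ∸ l)) (update G v l)
  F′~G′ = mirrors-update F~G v (n ∸ l) l refl
  distinct′ : EdgeLabelsDistinct (update F v (n ∸ l))
  distinct′ i j a b i≢j ei ej = distinct i j a b i≢j
    (trans (sym (mirrors-edges F′~G′ (bounded-update bnd v l l≤n) i)) ei)
    (trans (sym (mirrors-edges F′~G′ (bounded-update bnd v l l≤n) j)) ej)
  unused′ : ∀ w → F w ≢ just (n ∸ l)
  unused′ w fw with G w in gw
  ... | nothing with () ← trans (trans (sym fw) (F~G w)) (cong (complement n) gw)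
  ... | just c = unused w (trans gw (cong just (begin
    c              ≡⟨ m∸[m∸n]≡n (bnd w c gw) ⟨
    n ∸ (n ∸ c)    ≡⟨ cong (n ∸_) (just-injective (trans (sym (trans (F~G w) (cong (complement n) gw))) fw)) ⟩
    n ∸ (n ∸ l)    ≡⟨ m∸[m∸n]≡n l≤n ⟩
    l              ∎)))
    where open ≡-Reasoning

bob-wins-mirror : ∀ {n p} {G : Labeling n} → BobWins p G → Bounded G →
  ∀ F → Mirrors F G → BobWins p F
bob-wins-mirror {n} {G = G} (stuck incomplete no-move) bnd F F~G =
  stuck (λ full → incomplete (mirrors-full F~G full))
        (λ v l legal → no-move v (n ∸ l) (mirrors-legal (mirrors-sym bnd F~G) (mirrors-bounded F~G) legal))
bob-wins-mirror {n} {G = G} (alice-turn incomplete answer) bnd F F~G =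
  alice-turn (λ full → incomplete (mirrors-full F~G full)) λ v l legal →
    bob-wins-mirror (answer v (n ∸ l) (mirrors-legal (mirrors-sym bnd F~G) (mirrors-bounded F~G) legal))
      (bounded-update bnd v (n ∸ l) (m∸n≤m n l)) (update F v l)
      (mirrors-update F~G v l (n ∸ l) (cong just (sym (m∸[m∸n]≡n (proj₁ (proj₂ legal))))))
bob-wins-mirror {n} (bob-turn v l legal win) bnd F F~G =
  bob-turn v (n ∸ l) (mirrors-legal F~G bnd legal)
    (bob-wins-mirror win (bounded-update bnd v l (proj₁ (proj₂ legal))) (update F v (n ∸ l))
      (mirrors-update F~G v (n ∸ l) l refl))

distance-1 : ∀ k → ∣ suc k - k ∣ ≡ 1
distance-1 zero    = refl
distance-1 (suc k) = distance-1 k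

-- Bob's strategy on C_n for n = 8 + m.  Bob aims to make n or n − 1 dead.
module LargeCycle (m : ℕ) where

  n : ℕ
  n = 8 + m

  2≤n : 2 ≤ n
  2≤n = s≤s (s≤s z≤n)

  1≤n-1 : 1 ≤ n ∸ 1
  1≤n-1 = s≤s z≤n

  n≢1 : n ≢ 1
  n≢1 ()

  n≢n-1 : n ≢ n ∸ 1
  n≢n-1 = 1+n≢n

  apart : ∀ (x : Fin n) i j → {T (i <ᵇ 8)} → {T (j <ᵇ 8)} → {False (i ≟ j)} → walk i x ≢ walk j x
  apart x i j {i<8} {j<8} {i≢j} with <-cmp i j
  ... | tri< i<j _ _ = walk-distinct i j x i<j (≤-trans (<ᵇ⇒< j 8 j<8) (m≤m+n 8 m))
  ... | tri≈ _ i≡j _ = ⊥-elim (toWitnessFalse i≢j i≡j)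
  ... | tri> _ _ j<i = λ eq → walk-distinct j i x j<i (≤-trans (<ᵇ⇒< i 8 i<8) (m≤m+n 8 m)) (sym eq)

  -- Three arrangements, around 0 at x + 1, that kill n − 1: both neighbours
  -- of 0 differ from n − 1, and 1 is not next to n.
  dead-1-0-n : ∀ (g : Labeling n) x → g x ≡ just 1 → g (walk 1 x) ≡ just 0 → g (walk 2 x) ≡ just n →
    Dead g (n ∸ 1)
  dead-1-0-n g x g0 g1 g2 = dead-second g
    (separated-surrounded g g1 refl g2 g0 n≢n-1 (λ ()))
    (separated-apart g g0 g2 (apart x 1 2) (apart x 3 0))

  dead-n-0-1 : ∀ (g : Labeling n) x → g x ≡ just n → g (walk 1 x) ≡ just 0 → g (walk 2 x) ≡ just 1 →
    Dead g (n ∸ 1)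
  dead-n-0-1 g x g0 g1 g2 = dead-second g
    (separated-surrounded g g1 refl g2 g0 (λ ()) n≢n-1)
    (separated-apart g g2 g0 (apart x 3 0) (apart x 1 2))

  dead-a-0-n-n-1 : ∀ (g : Labeling n) x {a} → a ≢ n ∸ 1 → g x ≡ just a → g (walk 1 x) ≡ just 0 →
    g (walk 2 x) ≡ just n → g (walk 3 x) ≡ just (n ∸ 1) → Dead g (n ∸ 1)
  dead-a-0-n-n-1 g x a≢n-1 g0 g1 g2 g3 = dead-second g
    (separated-surrounded g g1 refl g2 g0 n≢n-1 a≢n-1)
    (separated-sym (separated-surrounded g g2 refl g3 g1 (λ ()) (λ ())))

  -- The position after Bob has put 0 right after x: x is free or carries a
  -- label other than n and n − 1, and every other vertex is free.
  record ZeroAfter (f : Labeling n) (x : Fin n) : Set where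
    field
      valid   : Valid f
      zero-at : f (walk 1 x) ≡ just 0
      support : ∀ z l → f z ≡ just l → z ≡ walk 1 x ⊎ (z ≡ x × l ≢ n × l ≢ n ∸ 1)

  module Reply {f : Labeling n} {x : Fin n} (st : ZeroAfter f x) {y : Fin n} {b : ℕ} (legal : Legal f y b) where
    open ZeroAfter st

    f′ : Labeling n
    f′ = update f y b

    valid′ : Valid f′
    valid′ = valid-move valid legal

    data Placed (z : Fin n) (l : ℕ) : Set where
      alice-new : z ≡ y → l ≡ b → Placed z l
      bob-zero  : z ≡ walk 1 x → l ≡ 0 → Placed z l
      at-x      : z ≡ x → f x ≡ just l → l ≢ n → l ≢ n ∸ 1 → Placed z l

    placed : ∀ z {l} → f′ z ≡ just l → Placed z l
    placed z {l} eq with update-cases f y b z eq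
    ... | inj₁ (z≡y , b≡l) = alice-new z≡y (sym b≡l)
    ... | inj₂ (_ , f-z) with support z l f-z
    ...   | inj₁ refl = bob-zero refl (just-injective (trans (sym f-z) zero-at))
    ...   | inj₂ (refl , l≢n , l≢n-1) = at-x refl f-z l≢n l≢n-1

    free′ : ∀ z → z ≢ y → z ≢ walk 1 x → z ≢ x → f′ z ≡ nothing
    free′ z z≢y z≢1 z≢x with f′ z in f-z
    ... | nothing = refl
    ... | just l with placed z f-z
    ...   | alice-new z≡y _ = ⊥-elim (z≢y z≡y)
    ...   | bob-zero z≡1 _ = ⊥-elim (z≢1 z≡1)
    ...   | at-x z≡x _ _ _ = ⊥-elim (z≢x z≡x)

    y≢1 : y ≢ walk 1 x
    y≢1 refl with () ← trans (sym (proj₁ legal)) zero-at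

    zero′ : f′ (walk 1 x) ≡ just 0
    zero′ = update-keeps f y b (walk 1 x) (≢-sym y≢1) zero-at

    at-y : f′ y ≡ just b
    at-y = update-same f y b

    labeled-edge : ∀ j {e} → edgeLabel f′ j ≡ just e →
      Σ ℕ λ p → Σ ℕ λ q → Placed j p × Placed (next j) q × ∣ p - q ∣ ≡ e
    labeled-edge j eq with edge-endpoints f′ j eq
    ... | p , q , fp , fq , p-q = p , q , placed j fp , placed (next j) fq , p-q

    module TopBesideZero (y≡2 : y ≡ walk 2 x) (b≡n : b ≡ n) where
      top′ : f′ (walk 2 x) ≡ just n
      top′ = subst (λ z → f′ z ≡ just n) y≡2 (trans at-y (cong just b≡n))

      x′ : f′ x ≡ f x
      x′ = update-other f y b x (λ x≡y → apart x 2 0 (trans (sym y≡2) (sym x≡y)))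

      edge-is-top : ∀ j {e} → edgeLabel f′ j ≡ just e → j ≢ x → e ≡ n
      edge-is-top j {e} eq j≢x with labeled-edge j eq
      ... | _ , _ , at-x j≡x _ _ _ , _ , _ = ⊥-elim (j≢x j≡x)
      ... | _ , q , alice-new j≡y _ , tail , _ = ⊥-elim (no-tail tail)
        where
        next-j : next j ≡ walk 3 x
        next-j = cong next (trans j≡y y≡2)
        no-tail : Placed (next j) q → ⊥
        no-tail (alice-new e _)  = apart x 3 2 (trans (sym next-j) (trans e y≡2))
        no-tail (bob-zero e _)   = apart x 3 1 (trans (sym next-j) e)
        no-tail (at-x e _ _ _)   = apart x 3 0 (trans (sym next-j) e)
      ... | p , q , bob-zero j≡1 p≡0 , tail , p-q = from-tail tail
        where
        next-j : next j ≡ walk 2 x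
        next-j = cong next j≡1
        from-tail : Placed (next j) q → e ≡ n
        from-tail (alice-new _ q≡b) = trans (sym p-q) (cong₂ ∣_-_∣ p≡0 (trans q≡b b≡n))
        from-tail (bob-zero e _)    = ⊥-elim (apart x 2 1 (trans (sym next-j) e))
        from-tail (at-x e _ _ _)    = ⊥-elim (apart x 2 0 (trans (sym next-j) e))

      x-free : f x ≡ nothing → BobWins bob f′
      x-free fx = dead-after-move-wins 2≤n 1≤n-1 (n≤1+n _) valid′ x 1 one
        (dead-1-0-n (update f′ x 1) x (update-same f′ x 1)
          (update-keeps f′ x 1 (walk 1 x) (apart x 1 0) zero′)
          (update-keeps f′ x 1 (walk 2 x) (apart x 2 0) top′))
        where
        pred-free : ∀ u → next u ≡ x → f′ u ≡ nothing
        pred-free u u→x = free′ u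
          (λ u≡y → apart x 3 0 (trans (cong next (sym (trans u≡y y≡2))) u→x))
          (λ u≡1 → apart x 2 0 (trans (cong next (sym u≡1)) u→x))
          (λ u≡x → next-irreflexive 2≤n u (trans u→x (sym u≡x)))
        unused : ∀ z → f′ z ≢ just 1
        unused z eq with placed z eq
        ... | alice-new _ 1≡b = n≢1 (trans (sym b≡n) (sym 1≡b))
        ... | at-x _ fx1 _ _ with () ← trans (sym fx) fx1
        one : Legal f′ x 1
        one = legal-before valid′ (trans x′ fx , s≤s z≤n , unused) pred-free
          (edge-from-endpoints (update f′ x 1) x (update-same f′ x 1) (update-keeps f′ x 1 (walk 1 x) (apart x 1 0) zero′))
          fresh
          where
          fresh : ∀ j {e} → edgeLabel f′ j ≡ just e → e ≢ 1
          fresh j eq with j F.≟ x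
          ... | no j≢x = λ e≡1 → n≢1 (trans (sym (edge-is-top j eq j≢x)) e≡1)
          ... | yes refl with edge-endpoints f′ j eq
          ...   | _ , _ , fj , _ with () ← trans (sym (trans x′ fx)) fj

      x-one : f x ≡ just 1 → BobWins bob f′
      x-one fx = dead-label-wins 2≤n 1≤n-1 (n≤1+n _) bob f′ valid′
        (dead-1-0-n f′ x (trans x′ fx) zero′ top′)

      x-other : ∀ a → f x ≡ just a → a ≢ 1 → BobWins bob f′
      x-other a fx a≢1 = dead-after-move-wins 2≤n 1≤n-1 (n≤1+n _) valid′ (walk 3 x) (n ∸ 1) second
        (dead-a-0-n-n-1 f″ x a≢n-1 (update-keeps f′ _ _ x (apart x 0 3) (trans x′ fx))
          (update-keeps f′ _ _ (walk 1 x) (apart x 1 3) zero′)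
          (update-keeps f′ _ _ (walk 2 x) (apart x 2 3) top′) (update-same f′ (walk 3 x) (n ∸ 1)))
        where
        f″ : Labeling n
        f″ = update f′ (walk 3 x) (n ∸ 1)
        a≢n-1 : a ≢ n ∸ 1
        a≢n-1 with support x a fx
        ... | inj₁ x≡1 = ⊥-elim (apart x 0 1 x≡1)
        ... | inj₂ (_ , _ , a≢n-1) = a≢n-1
        unused : ∀ z → f′ z ≢ just (n ∸ 1)
        unused z eq with placed z eq
        ... | alice-new _ n-1≡b = n≢n-1 (trans (sym b≡n) (sym n-1≡b))
        ... | at-x _ _ _ n-1≢n-1 = n-1≢n-1 refl
        fresh : ∀ j {e} → edgeLabel f′ j ≡ just e → e ≢ 1
        fresh j eq with j F.≟ x
        ... | no j≢x = λ e≡1 → n≢1 (trans (sym (edge-is-top j eq j≢x)) e≡1)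
        ... | yes refl with edge-endpoints f′ j eq
        ...   | p , q , fp , fq , p-q with trans (sym fp) (trans x′ fx) | trans (sym fq) zero′
        ...     | refl | refl = λ e≡1 → a≢1 (trans (sym (∣-∣-identityʳ p)) (trans p-q e≡1))
        second : Legal f′ (walk 3 x) (n ∸ 1)
        second = legal-after 2≤n {w = walk 3 x} {u = walk 2 x} valid′
          (free′ (walk 3 x) (λ e → apart x 3 2 (trans e y≡2)) (apart x 3 1) (apart x 3 0) , n≤1+n _ , unused)
          refl (free′ (walk 4 x) (λ e → apart x 4 2 (trans e y≡2)) (apart x 4 1) (apart x 4 0))
          (trans (edge-from-endpoints f″ (walk 2 x) (update-keeps f′ _ _ (walk 2 x) (apart x 2 3) top′)
                   (update-same f′ (walk 3 x) (n ∸ 1)))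
                 (cong just (distance-1 (n ∸ 1))))
          fresh

      win : BobWins bob f′
      win with f x in fx
      ... | nothing = x-free fx
      ... | just a with a ≟ 1
      ...   | yes refl = x-one fx
      ...   | no a≢1 = x-other a fx a≢1

    top-on-x : y ≡ x → b ≡ n → BobWins bob f′
    top-on-x refl b≡n = dead-after-move-wins 2≤n 1≤n-1 (n≤1+n _) valid′ (walk 2 x) 1 one
      (dead-n-0-1 f″ x (update-keeps f′ _ _ x (apart x 0 2) top′)
        (update-keeps f′ _ _ (walk 1 x) (apart x 1 2) zero′) (update-same f′ (walk 2 x) 1))
      where
      f″ : Labeling n
      f″ = update f′ (walk 2 x) 1
      top′ : f′ x ≡ just n
      top′ = trans at-y (cong just b≡n)
      x-was-free : f x ≡ nothing
      x-was-free = proj₁ legal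
      edge-is-top : ∀ j {e} → edgeLabel f′ j ≡ just e → e ≡ n
      edge-is-top j {e} eq with labeled-edge j eq
      ... | _ , _ , at-x _ fx _ _ , _ , _ with () ← trans (sym x-was-free) fx
      ... | _ , q , bob-zero j≡1 _ , tail , _ = ⊥-elim (no-tail tail)
        where
        no-tail : Placed (next j) q → ⊥
        no-tail (alice-new e _)  = apart x 2 0 (trans (cong next (sym j≡1)) e)
        no-tail (bob-zero e _)   = apart x 2 1 (trans (cong next (sym j≡1)) e)
        no-tail (at-x e _ _ _)   = apart x 2 0 (trans (cong next (sym j≡1)) e)
      ... | p , q , alice-new j≡x p≡b , tail , p-q = from-tail tail
        where
        from-tail : Placed (next j) q → e ≡ n
        from-tail (alice-new e _)   = ⊥-elim (apart x 1 0 (trans (cong next (sym j≡x)) e))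
        from-tail (bob-zero _ q≡0)  = trans (sym p-q) (trans (cong₂ ∣_-_∣ (trans p≡b b≡n) q≡0) (∣-∣-identityʳ n))
        from-tail (at-x _ fx _ _)   with () ← trans (sym x-was-free) fx
      unused : ∀ z → f′ z ≢ just 1
      unused z eq with placed z eq
      ... | alice-new _ 1≡b = n≢1 (trans (sym b≡n) (sym 1≡b))
      ... | at-x _ fx _ _ with () ← trans (sym x-was-free) fx
      one : Legal f′ (walk 2 x) 1
      one = legal-after 2≤n {w = walk 2 x} {u = walk 1 x} valid′
        (free′ (walk 2 x) (apart x 2 0) (apart x 2 1) (apart x 2 0) , s≤s z≤n , unused) refl
        (free′ (walk 3 x) (apart x 3 0) (apart x 3 1) (apart x 3 0))
        (edge-from-endpoints f″ (walk 1 x) (update-keeps f′ _ _ (walk 1 x) (apart x 1 2) zero′)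
          (update-same f′ (walk 2 x) 1))
        (λ j eq e≡1 → n≢1 (trans (sym (edge-is-top j eq)) e≡1))

    top-away : b ≡ n → y ≢ walk 2 x → y ≢ x → BobWins bob f′
    top-away b≡n y≢2 y≢x = dead-label-wins 2≤n (s≤s z≤n) ≤-refl bob f′ valid′
      (dead-top f′ (separated-apart f′ zero′ (trans at-y (cong just b≡n))
        (λ e → y≢2 (sym e)) (λ e → y≢x (next-injective e))))

    top-isolated : b ≢ n → ∀ k → f′ (walk k x) ≡ nothing → f′ (walk (1 + k) x) ≡ nothing →
      f′ (walk (2 + k) x) ≡ nothing → walk 1 x ≢ walk (1 + k) x → walk 2 x ≢ walk (1 + k) x →
      walk (2 + k) x ≢ walk 1 x → BobWins bob f′
    top-isolated b≢n k pred-free at-free succ-free 1≢w 2≢w w+1≢1 =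
      dead-after-move-wins 2≤n (s≤s z≤n) ≤-refl valid′ w n top
        (dead-top f″ (separated-apart f″ (update-keeps f′ w n (walk 1 x) 1≢w zero′)
          (update-same f′ w n) 2≢w w+1≢1))
      where
      w : Fin n
      w = walk (1 + k) x
      f″ : Labeling n
      f″ = update f′ w n
      unused : ∀ z → f′ z ≢ just n
      unused z eq with placed z eq
      ... | alice-new _ n≡b = b≢n (sym n≡b)
      ... | at-x _ _ n≢n _ = n≢n refl
      top : Legal f′ w n
      top = legal-isolated 2≤n {w = w} valid′ (at-free , ≤-refl , unused)
        (λ u u→w → subst (λ v → f′ v ≡ nothing) (sym (next-injective {a = u} {b = walk k x} u→w)) pred-free)
        succ-free

    -- Bob's two candidate places for n are x + 3 and x + 6; Alice's vertex y
    -- can spoil at most one of them.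
    top-at-3 : b ≢ n → y ≢ walk 2 x → y ≢ walk 3 x → y ≢ walk 4 x → BobWins bob f′
    top-at-3 b≢n y≢2 y≢3 y≢4 = top-isolated b≢n 2
      (free′ (walk 2 x) (≢-sym y≢2) (apart x 2 1) (apart x 2 0))
      (free′ (walk 3 x) (≢-sym y≢3) (apart x 3 1) (apart x 3 0))
      (free′ (walk 4 x) (≢-sym y≢4) (apart x 4 1) (apart x 4 0))
      (apart x 1 3) (apart x 2 3) (apart x 4 1)

    top-at-6 : b ≢ n → y ≢ walk 5 x → y ≢ walk 6 x → y ≢ walk 7 x → BobWins bob f′
    top-at-6 b≢n y≢5 y≢6 y≢7 = top-isolated b≢n 5
      (free′ (walk 5 x) (≢-sym y≢5) (apart x 5 1) (apart x 5 0))
      (free′ (walk 6 x) (≢-sym y≢6) (apart x 6 1) (apart x 6 0))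
      (free′ (walk 7 x) (≢-sym y≢7) (apart x 7 1) (apart x 7 0))
      (apart x 1 6) (apart x 2 6) (apart x 7 1)

    respond : BobWins bob f′
    respond with b ≟ n
    ... | yes b≡n with y F.≟ walk 2 x | y F.≟ x
    ...   | yes y≡2 | _       = TopBesideZero.win y≡2 b≡n
    ...   | no _    | yes y≡x = top-on-x y≡x b≡n
    ...   | no y≢2  | no y≢x  = top-away b≡n y≢2 y≢x
    respond | no b≢n with y F.≟ walk 2 x | y F.≟ walk 3 x | y F.≟ walk 4 x
    ... | no y≢2 | no y≢3 | no y≢4 = top-at-3 b≢n y≢2 y≢3 y≢4
    ... | yes refl | _ | _ = top-at-6 b≢n (apart x 2 5) (apart x 2 6) (apart x 2 7)
    ... | no _ | yes refl | _ = top-at-6 b≢n (apart x 3 5) (apart x 3 6) (apart x 3 7)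
    ... | no _ | no _ | yes refl = top-at-6 b≢n (apart x 4 5) (apart x 4 6) (apart x 4 7)

  zero-after-wins : ∀ {f x} → ZeroAfter f x → BobWins alice f
  zero-after-wins {f} {x} st = alice-turn incomplete (λ y b legal → Reply.respond st legal)
    where
    incomplete : ¬ Full f
    incomplete full with full (walk 4 x)
    ... | l , eq with ZeroAfter.support st (walk 4 x) l eq
    ...   | inj₁ 4≡1 = apart x 4 1 4≡1
    ...   | inj₂ (4≡0 , _) = apart x 4 0 4≡0

  bob-first : BobWins bob (emptyLabeling {n})
  bob-first = bob-turn (walk 1 x₀) 0 put-zero (zero-after-wins record
    { valid = valid-move valid-empty put-zero
    ; zero-at = update-same emptyLabeling (walk 1 x₀) 0
    ; support = support })
    where
    x₀ : Fin n
    x₀ = F.zero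
    put-zero : Legal emptyLabeling (walk 1 x₀) 0
    put-zero = legal-isolated 2≤n valid-empty (refl , z≤n , λ _ ()) (λ _ _ → refl) refl
    support : ∀ z l → update emptyLabeling (walk 1 x₀) 0 z ≡ just l →
      z ≡ walk 1 x₀ ⊎ (z ≡ x₀ × l ≢ n × l ≢ n ∸ 1)
    support z l eq with update-cases emptyLabeling (walk 1 x₀) 0 z eq
    ... | inj₁ (z≡1 , _) = inj₁ z≡1

  module Opening {x : Fin n} {a : ℕ} (legal : Legal emptyLabeling x a) where
    f₀ : Labeling n
    f₀ = update emptyLabeling x a

    valid₀ : Valid f₀
    valid₀ = valid-move valid-empty legal

    at-x : f₀ x ≡ just a
    at-x = update-same emptyLabeling x a

    only-x : ∀ z {l} → f₀ z ≡ just l → z ≡ x × a ≡ l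
    only-x z eq with update-cases emptyLabeling x a z eq
    ... | inj₁ z-is-x = z-is-x

    free₀ : ∀ z → z ≢ x → f₀ z ≡ nothing
    free₀ z z≢x = update-other emptyLabeling x a z z≢x

    no-edges : ∀ j {e} → edgeLabel f₀ j ≢ just e
    no-edges j eq with edge-endpoints f₀ j eq
    ... | _ , _ , fj , fj′ , _ =
      next-irreflexive 2≤n j (trans (proj₁ (only-x (next j) fj′)) (sym (proj₁ (only-x j fj))))

    fresh-label : ∀ {w c} → w ≢ x → a ≢ c → c ≤ n → FreshLabel f₀ w c
    fresh-label w≢x a≢c c≤n = free₀ _ w≢x , c≤n , λ z eq → a≢c (proj₂ (only-x z eq))

    at-distance-2 : ∀ c → a ≢ c → c ≤ n → Legal f₀ (walk 2 x) c
    at-distance-2 c a≢c c≤n = legal-isolated 2≤n valid₀ (fresh-label (apart x 2 0) a≢c c≤n)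
      (λ u u→2 → free₀ u (λ u≡x → apart x 2 1 (trans (sym u→2) (cong next u≡x))))
      (free₀ (walk 3 x) (apart x 3 0))

    beside : ∀ c → a ≢ c → c ≤ n → Legal f₀ (walk 1 x) c
    beside c a≢c c≤n = legal-after 2≤n {u = x} valid₀ (fresh-label (apart x 1 0) a≢c c≤n) refl
      (free₀ (walk 2 x) (apart x 2 0))
      (edge-from-endpoints (update f₀ (walk 1 x) c) x (update-keeps f₀ _ _ x (apart x 0 1) at-x)
        (update-same f₀ (walk 1 x) c))
      (λ j eq → ⊥-elim (no-edges j eq))

    zero-after : a ≢ 0 → a ≢ n → a ≢ n ∸ 1 → ZeroAfter (update f₀ (walk 1 x) 0) x
    zero-after a≢0 a≢n a≢n-1 = record
      { valid = valid-move valid₀ (beside 0 a≢0 z≤n)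
      ; zero-at = update-same f₀ (walk 1 x) 0
      ; support = support }
      where
      support : ∀ z l → update f₀ (walk 1 x) 0 z ≡ just l → z ≡ walk 1 x ⊎ (z ≡ x × l ≢ n × l ≢ n ∸ 1)
      support z l eq with update-cases f₀ (walk 1 x) 0 z eq
      ... | inj₁ (z≡1 , _) = inj₁ z≡1
      ... | inj₂ (_ , f-z) with only-x z f-z
      ...   | z≡x , refl = inj₂ (z≡x , a≢n , a≢n-1)

  answer-opening : ∀ x a → Legal emptyLabeling x a → BobWins bob (update emptyLabeling x a)
  answer-opening x a legal with a ≟ 0 | a ≟ n | a ≟ n ∸ 1
  ... | yes refl | _ | _ = dead-after-move-wins 2≤n (s≤s z≤n) ≤-refl valid₀ (walk 2 x) n put-top
      (dead-top _ (separated-apart _ (update-keeps f₀ _ _ x (apart x 0 2) at-x) (update-same f₀ (walk 2 x) n)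
        (apart x 1 2) (apart x 3 0)))
    where
    open Opening legal
    put-top = at-distance-2 n (λ ()) ≤-refl
  ... | no _ | yes refl | _ = dead-after-move-wins 2≤n (s≤s z≤n) ≤-refl valid₀ (walk 2 x) 0 put-zero
      (dead-top _ (separated-apart _ (update-same f₀ (walk 2 x) 0) (update-keeps f₀ _ _ x (apart x 0 2) at-x)
        (apart x 3 0) (apart x 1 2)))
    where
    open Opening legal
    put-zero = at-distance-2 0 (λ ()) z≤n
  ... | no _ | no _ | yes refl = bob-turn (walk 1 x) n (beside n (≢-sym n≢n-1) ≤-refl)
      (bob-wins-mirror (zero-after-wins (Opening.zero-after one (λ ()) (≢-sym n≢1) (λ ())))
        (Valid.bounded (ZeroAfter.valid (Opening.zero-after one (λ ()) (≢-sym n≢1) (λ ()))))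
        _ (mirrors-update (mirrors-update (λ _ → refl) x (n ∸ 1) 1 refl) (walk 1 x) n 0 refl))
    where
    -- Alice opened with n − 1: Bob answers n after it, the mirror image of
    -- answering an opening 1 with 0.
    open Opening legal
    one : Legal emptyLabeling x 1
    one = legal-isolated 2≤n valid-empty (refl , s≤s z≤n , λ _ ()) (λ _ _ → refl) refl
  ... | no a≢0 | no a≢n | no a≢n-1 =
      bob-turn (walk 1 x) 0 (beside 0 a≢0 z≤n) (zero-after-wins (zero-after a≢0 a≢n a≢n-1))
    where open Opening legal

  alice-first : BobWins alice (emptyLabeling {n})
  alice-first = alice-turn (λ full → nothing≢just (proj₂ (full F.zero))) answer-opening
    where
    nothing≢just : ∀ {l : ℕ} → nothing ≢ just l
    nothing≢just ()

  bob-wins : ∀ p → BobWins p (emptyLabeling {n})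
  bob-wins alice = alice-first
  bob-wins bob   = bob-first

-- Reading a decision lazily: branching only needs the boolean, and the
-- evidence is computed only if the resulting strategy is inspected.
affirm : ∀ {A : Set} (a? : Dec A) → does a? ≡ true → A
affirm (true because [a]) _ = invert [a]

refute : ∀ {A : Set} (a? : Dec A) → does a? ≡ false → ¬ A
refute (false because [¬a]) _ = invert [¬a]

first : ∀ {m} {A : Set} → (Fin m → Maybe A) → Maybe A
first {zero}  h = nothing
first {suc m} h with h fz
... | just a  = just a
... | nothing = first (λ i → h (fs i))

every : ∀ {m} {P : Fin m → Set} → ((i : Fin m) → Maybe (P i)) → Maybe ((i : Fin m) → P i)
every {zero}  h = just λ ()
every {suc m} {P} h with h fz | every {P = λ i → P (fs i)} (λ i → h (fs i))
... | just p | just ps = just λ { fz → p ; (fs i) → ps i }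
... | _      | _       = nothing

module Moves {n : ℕ} (f : Labeling n) (valid : Valid f)
             (P : Fin n → ℕ → Set) (try : ∀ v l → Legal f v l → Maybe (P v l)) where

  legal-at? : ∀ v l → Dec (Legal f v l)
  legal-at? = legal? f (Valid.distinct valid)

  some-move : Maybe (Σ (Fin n) λ v → Σ ℕ λ l → Legal f v l × P v l)
  some-move = first λ v → first λ (l : Fin (suc n)) → attempt v (toℕ l)
    where
    attempt : ∀ v l → Maybe (Σ (Fin n) λ v → Σ ℕ λ l → Legal f v l × P v l)
    attempt v l with does (legal-at? v l) in legal
    ... | true  = map (λ p → v , l , affirm (legal-at? v l) legal , p) (try v l (affirm (legal-at? v l) legal))
    ... | false = nothing

  every-move : Maybe (∀ v l → Legal f v l → P v l)
  every-move = map from-fin (every λ v → every λ (l : Fin (suc n)) → answer v (toℕ l))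
    where
    answer : ∀ v l → Maybe (Legal f v l → P v l)
    answer v l with does (legal-at? v l) in legal
    ... | true  = map (λ p _ → p) (try v l (affirm (legal-at? v l) legal))
    ... | false = just λ legal′ → ⊥-elim (refute (legal-at? v l) legal legal′)
    from-fin : (∀ v (l : Fin (suc n)) → Legal f v (toℕ l) → P v (toℕ l)) → ∀ v l → Legal f v l → P v l
    from-fin h v l legal@(_ , l≤n , _) =
      subst (λ l → Legal f v l → P v l) (FP.toℕ-fromℕ< (s≤s l≤n)) (h v (fromℕ< (s≤s l≤n))) legal

alice-search : ∀ {n} → ℕ → (p : Player) (f : Labeling n) → Valid f → Maybe (AliceWins p f)
alice-search d p f valid with full? f
... | yes full = just (done full)
alice-search zero p f valid | no _ = nothing
alice-search (suc d) alice f valid | no _ =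
  map (λ (v , l , legal , win) → alice-move v l legal win) (some-move f valid _
    λ v l legal → alice-search d bob (update f v l) (valid-move valid legal))
  where open Moves
alice-search (suc d) bob f valid | no _ with move? f (Valid.distinct valid)
... | no _ = nothing
... | yes some = map (bob-move some) (every-move f valid _
    λ v l legal → alice-search d alice (update f v l) (valid-move valid legal))
  where open Moves

-- Exhaustive search for a Bob strategy on C_(2+m); a branch is closed as
-- soon as the label n or n − 1 is no longer alive.
bob-search : ∀ m → ℕ → (p : Player) (f : Labeling (2 + m)) → Valid f → Maybe (BobWins p f)
bob-search m d p f valid with does (alive? f (2 + m)) in alive-n | does (alive? f (1 + m)) in alive-n-1
... | false | _ = just (dead-label-wins (s≤s (s≤s z≤n)) (s≤s z≤n) ≤-refl p f valid
                          (not-alive⇒dead f _ (refute (alive? f _) alive-n)))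
... | true | false = just (dead-label-wins (s≤s (s≤s z≤n)) (s≤s z≤n) (n≤1+n _) p f valid
                          (not-alive⇒dead f _ (refute (alive? f _) alive-n-1)))
bob-search m zero p f valid | true | true = nothing
bob-search m (suc d) bob f valid | true | true =
  map (λ (v , l , legal , win) → bob-turn v l legal win) (some-move f valid _
    λ v l legal → bob-search m d alice (update f v l) (valid-move valid legal))
  where open Moves
bob-search m (suc d) alice f valid | true | true with full? f
... | yes _ = nothing
... | no incomplete = map (alice-turn incomplete) (every-move f valid _
    λ v l legal → bob-search m d bob (update f v l) (valid-move valid legal))
  where open Moves

alice-wins-C3 : (first : Player) → AliceWins {3} first emptyLabeling
alice-wins-C3 alice = from-just (alice-search {3} 3 alice emptyLabeling valid-empty)
alice-wins-C3 bob   = from-just (alice-search {3} 3 bob emptyLabeling valid-empty)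

bob-wins-C : (n : ℕ) → 4 ≤ n → (first : Player) → BobWins {n} first emptyLabeling
bob-wins-C 0 ()
bob-wins-C 1 (s≤s ())
bob-wins-C 2 (s≤s (s≤s ()))
bob-wins-C 3 (s≤s (s≤s (s≤s ())))
bob-wins-C 4 _ alice = from-just (bob-search 2 4 alice emptyLabeling valid-empty)
bob-wins-C 4 _ bob   = from-just (bob-search 2 4 bob emptyLabeling valid-empty)
bob-wins-C 5 _ alice = from-just (bob-search 3 4 alice emptyLabeling valid-empty)
bob-wins-C 5 _ bob   = from-just (bob-search 3 3 bob emptyLabeling valid-empty)
bob-wins-C 6 _ alice = from-just (bob-search 4 4 alice emptyLabeling valid-empty)
bob-wins-C 6 _ bob   = from-just (bob-search 4 3 bob emptyLabeling valid-empty)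
bob-wins-C 7 _ alice = from-just (bob-search 5 4 alice emptyLabeling valid-empty)
bob-wins-C 7 _ bob   = from-just (bob-search 5 3 bob emptyLabeling valid-empty)
bob-wins-C (suc (suc (suc (suc (suc (suc (suc (suc m)))))))) _ = LargeCycle.bob-wins m

theorem3 : ((n : ℕ) → 4 ≤ n → (first : Player) → BobWins {n} first emptyLabeling)
           × ((first : Player) → AliceWins {3} first emptyLabeling)
theorem3 = bob-wins-C , alice-wins-C3
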